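{- Let $s\in\mathbb{N}$, let $D$ be an $n\times n$ distance matrix, let $D^{(q)}$ denote the distance matrix of the $q$-skeleton of $D$, and let $(G,\Phi)$ be a graph realisation of $D$. If $G$ contains no elementary path of length greater than $s$, then $D^{(s)}=D$.
   Context: $[n]=\{1,\dots,n\}$. An $n\times n$ matrix $D$ with non-negative integer entries is a distance matrix if all diagonal entries are $0$, all off-diagonal entries are strictly positive, $D$ is symmetric, and $D_{iw}+D_{wj}\ge D_{ij}$ for all $i,j,w$. A graph realisation of $D$ is a pair $(G,\Phi)$ with $G=(V,E)$ a finite simple undirected unweighted graph and $\Phi:[n]\to V$ injective such that $d_G(\Phi(i),\Phi(j))=D_{ij}$ for all $i,j$ ($d_G$ the shortest-path distance). For a graph realisation $(G,\Phi)$, an elementary path is a path in $G$ of length $D_{ij}$ between $\Phi(i)$ and $\Phi(j)$ (for some $i,j\in[n]$) none of whose interior vertices lies in $\Phi([n])$. For $q\in\mathbb{N}$, the $q$-skeleton of $D$ is the edge-weighted graph on vertex set $[n]$ with an edge $\{i,j\}$ ($i<j$) iff $D_{ij}\le q$, of weight $D_{ij}$; $D^{(q)}_{ij}$ is the weighted shortest-path distance from $i$ to $j$ in it ($\infty$ if none). -}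

module Defs where

open import Data.Nat using (ℕ; zero; suc; _+_; _≤_; _<_)
open import Data.Fin using (Fin; zero; suc; inject₁; fromℕ; toℕ)
open import Data.Bool using (Bool; true)
open import Data.Maybe using (Maybe; just; nothing)
open import Data.Product using (Σ; _×_; ∃)
open import Data.Empty using (⊥)
open import Relation.Nullary using (¬_)
open import Relation.Binary.PropositionalEquality using (_≡_; _≢_)
open import Function.Definitions using (Injective)

∑ : (k : ℕ) → (Fin k → ℕ) → ℕ
∑ zero    f = 0
∑ (suc k) f = f zero + ∑ k (λ t → f (suc t))

Matrix : ℕ → Set
Matrix n = Fin n → Fin n → ℕ

record IsDistanceMatrix {n : ℕ} (D : Matrix n) : Set where
  field
    diag-zero : ∀ i → D i i ≡ 0
    off-pos   : ∀ i j → i ≢ j → 0 < D i j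
    symmetric : ∀ i j → D i j ≡ D j i
    triangle  : ∀ i j w → D i j ≤ D i w + D w j

record Graph : Set where
  field
    size   : ℕ
    adj    : Fin size → Fin size → Bool
    adj-sym     : ∀ u v → adj u v ≡ adj v u
    adj-irrefl  : ∀ u → ¬ (adj u u ≡ true)

open Graph public

Vertex : Graph → Set
Vertex G = Fin (size G)

record Walk (G : Graph) (k : ℕ) (u v : Vertex G) : Set where
  field
    vert  : Fin (suc k) → Vertex G
    start : vert zero ≡ u
    end   : vert (fromℕ k) ≡ v
    step  : ∀ (t : Fin k) → adj G (vert (inject₁ t)) (vert (suc t)) ≡ true

open Walk public

IsPath : ∀ {G k u v} → Walk G k u v → Set
IsPath {G} {k} w = Injective _≡_ _≡_ (vert w)

GraphDist : (G : Graph) → Vertex G → Vertex G → ℕ → Set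
GraphDist G u v d = Walk G d u v × (∀ k → Walk G k u v → d ≤ k)

record GraphRealisation {n : ℕ} (D : Matrix n) (G : Graph) (Φ : Fin n → Vertex G) : Set where
  field
    Φ-injective : Injective _≡_ _≡_ Φ
    realises    : ∀ i j → GraphDist G (Φ i) (Φ j) (D i j)

record ElementaryPath {n : ℕ} (D : Matrix n) (G : Graph) (Φ : Fin n → Vertex G)
                      (i j : Fin n) : Set where
  field
    path     : Walk G (D i j) (Φ i) (Φ j)
    isPath   : IsPath path
    interior : ∀ (t : Fin (suc (D i j))) → toℕ t ≢ 0 → toℕ t ≢ D i j →
               ∀ (l : Fin n) → Φ l ≢ vert path t

-- edge {a,b} (a ≠ b) present iff D a b ≤ q, with weight D a b
SkelEdge : ∀ {n} → ℕ → Matrix n → Fin n → Fin n → Set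
SkelEdge q D a b = (a ≢ b) × (D a b ≤ q)

record SkelWalk {n : ℕ} (q : ℕ) (D : Matrix n) (k : ℕ) (i j : Fin n) : Set where
  field
    svert  : Fin (suc k) → Fin n
    sstart : svert zero ≡ i
    send   : svert (fromℕ k) ≡ j
    sstep  : ∀ (t : Fin k) → SkelEdge q D (svert (inject₁ t)) (svert (suc t))

open SkelWalk public

weight : ∀ {n q D k i j} → SkelWalk {n} q D k i j → ℕ
weight {D = D} {k = k} w = ∑ k (λ t → D (svert w (inject₁ t)) (svert w (suc t)))

-- SkelDist q D i j x  means  D^(q)_ij = x  (nothing = ∞)
SkelDist : ∀ {n} → ℕ → Matrix n → Fin n → Fin n → Maybe ℕ → Set
SkelDist q D i j (just d) =
  (Σ ℕ λ k → Σ (SkelWalk q D k i j) λ w → weight w ≡ d) ×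
  (∀ k (w : SkelWalk q D k i j) → d ≤ weight w)
SkelDist q D i j nothing = ∀ k → ¬ SkelWalk q D k i j

{-# OPTIONS --safe #-}
-- Cut a shortest walk from Φ i to Φ j at the vertices lying in the image of Φ.
-- A piece between consecutive cuts Φ a (at position p) and Φ b (at position r)
-- is tight, D a b = r - p: it shows D a b ≤ r - p, and the triangle inequality
-- D i j ≤ D i a + D a b + D b j ≤ p + D a b + (D i j - r) shows the converse.
-- So each piece is a shortest walk, hence a path, hence an elementary path, and
-- the hypothesis gives D a b ≤ s. The cut vertices thus form a walk in the
-- s-skeleton of weight D i j; no skeleton walk is lighter, by the triangle
-- inequality again.
module Submission where

open import Defs
open import Data.Nat using (ℕ; zero; suc; _+_; _∸_; _≤_; _<_; _>_; _<?_; s≤s)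
open import Data.Nat.Properties
open import Data.Fin using (Fin; zero; suc; toℕ; fromℕ; fromℕ<; inject₁)
open import Data.Fin.Properties
  using (toℕ-injective; toℕ-fromℕ; toℕ-fromℕ<; toℕ-inject₁; toℕ<n; toℕ≤pred[n]; any?)
  renaming (_≟_ to _≟ᶠ_)
open import Data.Maybe using (just)
open import Data.Product using (Σ; ∃; _,_; proj₁; proj₂)
open import Data.Sum using (inj₁; inj₂)
open import Data.Bool using (true)
open import Relation.Nullary using (¬_; Dec; yes; no; contradiction)
open import Relation.Binary.PropositionalEquality
open import Relation.Binary.Definitions using (tri<; tri≈; tri>)

module _ {n q : ℕ} {D : Matrix n} where

  [] : ∀ {a} → SkelWalk q D 0 a a
  [] {a} = record { svert = λ _ → a ; sstart = refl ; send = refl ; sstep = λ () }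

  _◅_ : ∀ {k a b j} → SkelEdge q D a b → SkelWalk q D k b j → SkelWalk q D (suc k) a j
  _◅_ {a = a} e w = record
    { svert  = λ { zero → a ; (suc t) → svert w t }
    ; sstart = refl
    ; send   = send w
    ; sstep  = λ { zero → subst (SkelEdge q D a) (sym (sstart w)) e ; (suc t) → sstep w t }
    }

  weight-◅ : ∀ {k a b j} (e : SkelEdge q D a b) (w : SkelWalk q D k b j) →
             weight (e ◅ w) ≡ D a b + weight w
  weight-◅ {a = a} e w = cong (λ c → D a c + weight w) (sstart w)

  tail : ∀ {k i j} (w : SkelWalk q D (suc k) i j) → SkelWalk q D k (svert w (suc zero)) j
  tail w = record
    { svert = λ t → svert w (suc t) ; sstart = refl ; send = send w ; sstep = λ t → sstep w (suc t) }

  weight-≥ : IsDistanceMatrix D → ∀ {k i j} (w : SkelWalk q D k i j) → D i j ≤ weight w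
  weight-≥ isD {zero} w =
    ≤-reflexive (trans (cong₂ D (sym (sstart w)) (sym (send w))) (diag-zero _))
    where open IsDistanceMatrix isD
  weight-≥ isD {suc k} {i} {j} w = begin
    D i j                       ≤⟨ triangle i j m ⟩
    D i m + D m j               ≡⟨ cong (λ c → D c m + D m j) (sym (sstart w)) ⟩
    D (svert w zero) m + D m j  ≤⟨ +-monoʳ-≤ (D (svert w zero) m) (weight-≥ isD (tail w)) ⟩
    weight w                    ∎
    where
    open IsDistanceMatrix isD
    open ≤-Reasoning
    m : Fin n
    m = svert w (suc zero)

-- Walks indexed by ℕ instead of Fin, so that positions along a walk can be
-- added and subtracted; 'at' carries no information past the length.
record ℕWalk (G : Graph) (k : ℕ) (u v : Vertex G) : Set where
  field
    at       : ℕ → Vertex G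
    at-start : at 0 ≡ u
    at-end   : at k ≡ v
    at-step  : ∀ t → t < k → adj G (at t) (at (suc t)) ≡ true

open ℕWalk

clamp : (k : ℕ) → ℕ → Fin (suc k)
clamp k       zero    = zero
clamp zero    (suc t) = zero
clamp (suc k) (suc t) = suc (clamp k t)

clamp-toℕ : ∀ k (t : Fin (suc k)) → clamp k (toℕ t) ≡ t
clamp-toℕ k       zero          = refl
clamp-toℕ zero    (suc ())
clamp-toℕ (suc k) (suc t)       = cong suc (clamp-toℕ k t)

x<y≤k⇒x+[k∸y]<k : ∀ {x y k} → x < y → y ≤ k → x + (k ∸ y) < k
x<y≤k⇒x+[k∸y]<k {x} {y} {k} x<y y≤k =
  subst (x + (k ∸ y) <_) (m+[n∸m]≡n y≤k) (+-monoˡ-< (k ∸ y) x<y)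

module _ {G : Graph} where

  fromWalk : ∀ {k u v} → Walk G k u v → ℕWalk G k u v
  fromWalk {k} w = record
    { at       = λ t → vert w (clamp k t)
    ; at-start = start w
    ; at-end   = trans (cong (vert w) clamp-k) (end w)
    ; at-step  = λ t t<k → subst (λ x → adj G (vert w (clamp k x)) (vert w (clamp k (suc x))) ≡ true)
                                 (toℕ-fromℕ< t<k) (step-toℕ (fromℕ< t<k))
    }
    where
    clamp-k : clamp k k ≡ fromℕ k
    clamp-k = trans (cong (clamp k) (sym (toℕ-fromℕ k))) (clamp-toℕ k (fromℕ k))
    step-toℕ : ∀ t → adj G (vert w (clamp k (toℕ t))) (vert w (clamp k (suc (toℕ t)))) ≡ true
    step-toℕ t = subst₂ (λ x y → adj G (vert w x) (vert w y) ≡ true)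
      (sym (trans (cong (clamp k) (sym (toℕ-inject₁ t))) (clamp-toℕ k (inject₁ t))))
      (sym (clamp-toℕ k (suc t)))
      (step w t)

  toWalk : ∀ {k u v} → ℕWalk G k u v → Walk G k u v
  toWalk {k} w = record
    { vert  = λ t → at w (toℕ t)
    ; start = at-start w
    ; end   = trans (cong (at w) (toℕ-fromℕ k)) (at-end w)
    ; step  = λ t → subst (λ x → adj G (at w x) (at w (suc (toℕ t))) ≡ true)
                          (sym (toℕ-inject₁ t)) (at-step w (toℕ t) (toℕ<n t))
    }

  cast : ∀ {k k′ u u′ v v′} → k ≡ k′ → u ≡ u′ → v ≡ v′ → ℕWalk G k u v → ℕWalk G k′ u′ v′
  cast k≡k′ u≡u′ v≡v′ w = record
    { at       = at w
    ; at-start = trans (at-start w) u≡u′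
    ; at-end   = trans (cong (at w) (sym k≡k′)) (trans (at-end w) v≡v′)
    ; at-step  = λ t t<k′ → at-step w t (subst (t <_) (sym k≡k′) t<k′)
    }

  segment : ∀ {k u v} (w : ℕWalk G k u v) p m → p + m ≤ k → ℕWalk G m (at w p) (at w (p + m))
  segment w p m p+m≤k = record
    { at       = λ t → at w (p + t)
    ; at-start = cong (at w) (+-identityʳ p)
    ; at-end   = refl
    ; at-step  = λ t t<m → subst (λ x → adj G (at w (p + t)) (at w x) ≡ true) (sym (+-suc p t))
                                 (at-step w (p + t) (<-≤-trans (+-monoʳ-< p t<m) p+m≤k))
    }

  _++_ : ∀ {k m u v x} → ℕWalk G k u v → ℕWalk G m v x → ℕWalk G (k + m) u x
  _++_ {k} {m} {u} {v} {x} w₁ w₂ = record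
    { at = at′ ; at-start = at′-start ; at-end = at′-end ; at-step = at′-step }
    where
    pick : ∀ t → Dec (t < k) → Vertex G
    pick t (yes _) = at w₁ t
    pick t (no _)  = at w₂ (t ∸ k)

    at′ : ℕ → Vertex G
    at′ t = pick t (t <? k)

    at′-start : at′ 0 ≡ u
    at′-start with 0 <? k
    ... | yes _   = at-start w₁
    ... | no  0≮k = begin
      at w₂ (0 ∸ k)  ≡⟨ cong (at w₂) (0∸n≡0 k) ⟩
      at w₂ 0        ≡⟨ at-start w₂ ⟩
      v              ≡⟨ sym (at-end w₁) ⟩
      at w₁ k        ≡⟨ cong (at w₁) (n≤0⇒n≡0 (≮⇒≥ 0≮k)) ⟩
      at w₁ 0        ≡⟨ at-start w₁ ⟩
      u              ∎
      where open ≡-Reasoning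

    at′-end : at′ (k + m) ≡ x
    at′-end with k + m <? k
    ... | yes k+m<k = contradiction k+m<k (≤⇒≯ (m≤m+n k m))
    ... | no  _     = trans (cong (at w₂) (m+n∸m≡n k m)) (at-end w₂)

    at′-step : ∀ t → t < k + m → adj G (at′ t) (at′ (suc t)) ≡ true
    at′-step t t<k+m with t <? k | suc t <? k
    ... | yes t<k | yes _     = at-step w₁ t t<k
    ... | yes t<k | no  1+t≮k = subst (λ y → adj G (at w₁ t) y ≡ true) crossing (at-step w₁ t t<k)
      where
      1+t≡k : suc t ≡ k
      1+t≡k = ≤-antisym t<k (≮⇒≥ 1+t≮k)
      crossing : at w₁ (suc t) ≡ at w₂ (suc t ∸ k)
      crossing = trans (cong (at w₁) 1+t≡k)
        (trans (at-end w₁) (trans (sym (at-start w₂)) (cong (at w₂) (sym (m≤n⇒m∸n≡0 (≤-reflexive 1+t≡k))))))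
    ... | no t≮k  | yes 1+t<k = contradiction (<-trans (n<1+n t) 1+t<k) t≮k
    ... | no t≮k  | no _      =
      subst (λ y → adj G (at w₂ (t ∸ k)) (at w₂ y) ≡ true) (sym (+-∸-assoc 1 k≤t))
            (at-step w₂ (t ∸ k) (subst (t ∸ k <_) (m+n∸m≡n k m) (∸-monoˡ-< t<k+m k≤t)))
      where
      k≤t : k ≤ t
      k≤t = ≮⇒≥ t≮k

  shortcut : ∀ {k u v} (w : ℕWalk G k u v) {x y} → x ≤ y → y ≤ k → at w x ≡ at w y →
             ℕWalk G (x + (k ∸ y)) u v
  shortcut {k} w {x} {y} x≤y y≤k loop =
    cast refl (at-start w) refl (segment w 0 x (≤-trans x≤y y≤k))
    ++ cast refl (sym loop) (trans (cong (at w) (m+[n∸m]≡n y≤k)) (at-end w))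
            (segment w y (k ∸ y) (≤-reflexive (m+[n∸m]≡n y≤k)))

  shortest-injective : ∀ {k u v} (w : ℕWalk G k u v) → (∀ k′ → ℕWalk G k′ u v → k ≤ k′) →
                       ∀ {x y} → x ≤ k → y ≤ k → at w x ≡ at w y → x ≡ y
  shortest-injective w shortest {x} {y} x≤k y≤k loop with <-cmp x y
  ... | tri< x<y _ _ = contradiction (shortest _ (shortcut w (<⇒≤ x<y) y≤k loop))
                                     (<⇒≱ (x<y≤k⇒x+[k∸y]<k x<y y≤k))
  ... | tri≈ _ x≡y _ = x≡y
  ... | tri> _ _ y<x = contradiction (shortest _ (shortcut w (<⇒≤ y<x) x≤k (sym loop)))
                                     (<⇒≱ (x<y≤k⇒x+[k∸y]<k y<x x≤k))

D≤walk-length : ∀ {n} {D : Matrix n} {G Φ} → GraphRealisation D G Φ →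
                ∀ {k a b} → ℕWalk G k (Φ a) (Φ b) → D a b ≤ k
D≤walk-length R {k} {a} {b} w = proj₂ (GraphRealisation.realises R a b) k (toWalk w)

module Geodesic {n : ℕ} {D : Matrix n} (isD : IsDistanceMatrix D)
                {G : Graph} {Φ : Fin n → Vertex G} (R : GraphRealisation D G Φ)
                (i j : Fin n) where

  open IsDistanceMatrix isD
  open GraphRealisation R

  L : ℕ
  L = D i j

  geodesic : ℕWalk G L (Φ i) (Φ j)
  geodesic = fromWalk (proj₁ (realises i j))

  γ : ℕ → Vertex G
  γ = at geodesic

  D≤gap : ∀ {p e a b} → p + e ≤ L → γ p ≡ Φ a → γ (p + e) ≡ Φ b → D a b ≤ e
  D≤gap {p} {e} p+e≤L γp γp+e = D≤walk-length R (cast refl γp γp+e (segment geodesic p e p+e≤L))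

  gap-length : ∀ {p e x a b} → p + e + x ≡ L → γ p ≡ Φ a → γ (p + e) ≡ Φ b → D a b ≡ e
  gap-length {p} {e} {x} {a} {b} split γp γp+e =
    ≤-antisym (D≤gap p+e≤L γp γp+e) (+-cancelʳ-≤ x e (D a b) (+-cancelˡ-≤ p _ _ detour))
    where
    open ≤-Reasoning
    p+e≤L : p + e ≤ L
    p+e≤L = subst (p + e ≤_) split (m≤m+n (p + e) x)
    detour : p + (e + x) ≤ p + (D a b + x)
    detour = begin
      p + (e + x)              ≡⟨ trans (sym (+-assoc p e x)) split ⟩
      D i j                    ≤⟨ triangle i j a ⟩
      D i a + D a j            ≤⟨ +-monoʳ-≤ (D i a) (triangle a j b) ⟩
      D i a + (D a b + D b j)  ≤⟨ +-mono-≤ (D≤gap {0} (m+n≤o⇒m≤o p p+e≤L) (at-start geodesic) γp)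
                                           (+-monoʳ-≤ (D a b) (D≤gap (≤-reflexive split) γp+e
                                             (trans (cong γ split) (at-end geodesic)))) ⟩
      p + (D a b + x)          ∎

  Marked : ℕ → Set
  Marked t = ∃ λ l → Φ l ≡ γ t

  marked? : ∀ t → Dec (Marked t)
  marked? t = any? (λ l → Φ l ≟ᶠ γ t)

  UnmarkedAfter : ℕ → ℕ → Set
  UnmarkedAfter p d = ∀ u → u < d → ¬ Marked (p + suc u)

  unmarkedAfter-suc : ∀ {p d} → UnmarkedAfter p d → ¬ Marked (p + suc d) → UnmarkedAfter p (suc d)
  unmarkedAfter-suc unmarked next u u<1+d with m<1+n⇒m<n∨m≡n u<1+d
  ... | inj₁ u<d  = unmarked u u<d
  ... | inj₂ refl = next

  elementary-gap : ∀ {p d x a b} → p + suc d + x ≡ L → γ p ≡ Φ a → γ (p + suc d) ≡ Φ b →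
                   UnmarkedAfter p d → ElementaryPath D G Φ a b
  elementary-gap {p} {d} {x} {a} {b} split γp γq unmarked = record
    { path     = toWalk piece
    ; isPath   = λ loop → toℕ-injective
                   (shortest-injective piece (λ _ → D≤walk-length R) (toℕ≤pred[n] _) (toℕ≤pred[n] _) loop)
    ; interior = λ t t≢0 t≢Dab → interior-ℕ (toℕ t) t≢0
                   (≤∧≢⇒< (subst (toℕ t ≤_) Dab≡1+d (toℕ≤pred[n] t)) (λ t≡ → t≢Dab (trans t≡ (sym Dab≡1+d))))
    }
    where
    Dab≡1+d : D a b ≡ suc d
    Dab≡1+d = gap-length split γp γq
    piece : ℕWalk G (D a b) (Φ a) (Φ b)
    piece = cast (sym Dab≡1+d) γp γq
                 (segment geodesic p (suc d) (subst (p + suc d ≤_) split (m≤m+n (p + suc d) x)))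
    interior-ℕ : ∀ u → u ≢ 0 → u < suc d → ∀ l → Φ l ≢ γ (p + u)
    interior-ℕ zero    u≢0 _                = contradiction refl u≢0
    interior-ℕ (suc u) _   (s≤s u<d) l Φl≡γ = unmarked u u<d (l , Φl≡γ)

  module _ {s : ℕ} (short : ∀ a b → D a b > s → ¬ ElementaryPath D G Φ a b) where

    SkelTail : Fin n → ℕ → Set
    SkelTail a p = Σ ℕ λ k → Σ (SkelWalk s D k a j) λ w → p + weight w ≡ L

    prepend-gap : ∀ {p d x a b} → p + suc d + x ≡ L → γ p ≡ Φ a → γ (p + suc d) ≡ Φ b →
                  UnmarkedAfter p d → SkelTail b (p + suc d) → SkelTail a p
    prepend-gap {p} {d} {x} {a} {b} split γp γq unmarked (k , w , w-weight) =
      suc k , edge ◅ w , (begin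
        p + weight (edge ◅ w)    ≡⟨ cong (p +_) (weight-◅ edge w) ⟩
        p + (D a b + weight w)   ≡⟨ cong (λ c → p + (c + weight w)) Dab≡1+d ⟩
        p + (suc d + weight w)   ≡⟨ sym (+-assoc p (suc d) (weight w)) ⟩
        p + suc d + weight w     ≡⟨ w-weight ⟩
        L                        ∎)
      where
      open ≡-Reasoning
      Dab≡1+d : D a b ≡ suc d
      Dab≡1+d = gap-length split γp γq
      a≢b : a ≢ b
      a≢b refl = 0≢1+n (trans (sym (diag-zero a)) Dab≡1+d)
      edge : SkelEdge s D a b
      edge = a≢b , ≮⇒≥ (λ Dab>s → short a b Dab>s (elementary-gap split γp γq unmarked))

    -- In scan, the last cut is at p, the d positions after it are unmarked, and
    -- position p + suc d is inspected next; m counts the positions beyond it.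
    skeleton-walk-from : ∀ m p {a} → p + m ≡ L → γ p ≡ Φ a → SkelTail a p
    scan : ∀ m p d {a} → p + suc d + m ≡ L → γ p ≡ Φ a → UnmarkedAfter p d → SkelTail a p

    skeleton-walk-from zero p split γp
      with Φ-injective (trans (sym γp) (trans (cong γ (trans (sym (+-identityʳ p)) split)) (at-end geodesic)))
    ... | refl = 0 , [] , split
    skeleton-walk-from (suc m) p split γp = scan m p 0 (trans (+-assoc p 1 m) split) γp (λ _ ())

    scan m p d split γp unmarked with marked? (p + suc d)
    ... | yes (b , Φb≡γ) = prepend-gap split γp (sym Φb≡γ) unmarked
                             (skeleton-walk-from m (p + suc d) split (sym Φb≡γ))
    scan zero p d split γp unmarked | no unmarked-end =
      contradiction (j , sym (trans (cong γ (trans (sym (+-identityʳ (p + suc d))) split)) (at-end geodesic)))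
                    unmarked-end
    scan (suc m) p d split γp unmarked | no unmarked-next =
      scan m p (suc d) (trans (trans (cong (_+ m) (+-suc p (suc d))) (sym (+-suc (p + suc d) m))) split)
           γp (unmarkedAfter-suc unmarked unmarked-next)

proposition4 : (s n : ℕ) (D : Matrix n) → IsDistanceMatrix D →
    (G : Graph) (Φ : Fin n → Vertex G) → GraphRealisation D G Φ →
    (∀ i j → D i j > s → ¬ ElementaryPath D G Φ i j) →
    ∀ i j → SkelDist s D i j (just (D i j))
proposition4 s n D isD G Φ R short i j =
  skeleton-walk-from short (D i j) 0 refl (at-start geodesic) , λ _ → weight-≥ isD
  where open Geodesic isD R i j
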